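{- Let $G$ be a finite digraph, $P$ a finite poset and $k\ge 1$. (a) If $P$ has a minimum element $0$ and $c$ is a $P$-coloring of the $k$-walks of $G$, then $c(v_1\dots v_k)=0$ implies that $v_k$ has no out-neighbor (i.e. $v_k$ is a sink or isolated). (b) If the $k$-walks of $G$ are $P$-colorable, then there exists a $P$-coloring $c$ of the $k$-walks such that $c(v_1\dots v_k)$ is a minimal element of $P$ whenever $v_k$ is a sink.
   Context: A digraph has finite vertex set and edges that are ordered pairs of distinct vertices; write $u\to v$ for an edge. A sink is a vertex with no outgoing edges. A $k$-walk is a sequence $(v_1\dots v_k)$ with $v_1\to\dots\to v_k$. A $P$-coloring of the $k$-walks is a map $c$ from $k$-walks to $P$ with $c(v_1\dots v_k)\not\le c(v_2\dots v_{k+1})$ for every $(k+1)$-walk $(v_1\dots v_{k+1})$. -}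

module Defs where

open import Data.Nat using (ℕ; zero; suc)
open import Data.Fin using (Fin)
open import Data.Bool using (Bool; T; false)
open import Data.Vec using (Vec; []; _∷_; last)
open import Data.Unit using (⊤; tt)
open import Data.Product using (Σ; _×_; _,_; proj₁; proj₂; ∃)
open import Data.Empty using (⊥)
open import Relation.Nullary using (¬_)
open import Relation.Binary.PropositionalEquality using (_≡_)
open import Relation.Binary.Bundles using (DecPoset)
open import Function.Bundles using (_↔_)
open import Level using (0ℓ)

record Digraph : Set where
  field
    n     : ℕ
    adj   : Fin n → Fin n → Bool
    irrefl : ∀ u → adj u u ≡ false

open Digraph public

Vertex : Digraph → Set
Vertex G = Fin (n G)

Edge : (G : Digraph) → Vertex G → Vertex G → Set
Edge G u v = T (adj G u v)

IsSink : (G : Digraph) → Vertex G → Set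
IsSink G v = ∀ u → ¬ Edge G v u

IsWalk : (G : Digraph) → ∀ {k} → Vec (Vertex G) k → Set
IsWalk G [] = ⊤
IsWalk G (x ∷ []) = ⊤
IsWalk G (x ∷ y ∷ xs) = Edge G x y × IsWalk G (y ∷ xs)

Walk : Digraph → ℕ → Set
Walk G k = Σ (Vec (Vertex G) k) (IsWalk G)

dropLast : ∀ {A : Set} {k} → Vec A (suc k) → Vec A k
dropLast (x ∷ []) = []
dropLast (x ∷ y ∷ xs) = x ∷ dropLast (y ∷ xs)

dropLast-walk : (G : Digraph) → ∀ {k} (xs : Vec (Vertex G) (suc k)) →
                IsWalk G xs → IsWalk G (dropLast xs)
dropLast-walk G (x ∷ []) p = tt
dropLast-walk G (x ∷ y ∷ []) p = tt
dropLast-walk G (x ∷ y ∷ z ∷ xs) (e , p) = e , dropLast-walk G (y ∷ z ∷ xs) p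

tail-walk : (G : Digraph) → ∀ {k} (xs : Vec (Vertex G) (suc k)) →
            IsWalk G xs → IsWalk G (Data.Vec.tail xs)
tail-walk G (x ∷ []) p = tt
tail-walk G (x ∷ y ∷ xs) (e , p) = p

walkInit : (G : Digraph) → ∀ {k} → Walk G (suc k) → Walk G k
walkInit G (xs , p) = dropLast xs , dropLast-walk G xs p

walkTail : (G : Digraph) → ∀ {k} → Walk G (suc k) → Walk G k
walkTail G (xs , p) = Data.Vec.tail xs , tail-walk G xs p

walkLast : (G : Digraph) → ∀ {k} → Walk G (suc k) → Vertex G
walkLast G (xs , _) = last xs

IsFinite : DecPoset 0ℓ 0ℓ 0ℓ → Set
IsFinite P = ∃ λ m → DecPoset.Carrier P ↔ Fin m

IsColoring : (G : Digraph) (P : DecPoset 0ℓ 0ℓ 0ℓ) (k : ℕ) →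
             (Walk G k → DecPoset.Carrier P) → Set
IsColoring G P k c =
  ∀ (w : Walk G (suc k)) → ¬ (DecPoset._≤_ P (c (walkInit G w)) (c (walkTail G w)))

IsMinimum : (P : DecPoset 0ℓ 0ℓ 0ℓ) → DecPoset.Carrier P → Set
IsMinimum P z = ∀ x → DecPoset._≤_ P z x

IsMinimal : (P : DecPoset 0ℓ 0ℓ 0ℓ) → DecPoset.Carrier P → Set
IsMinimal P m = ∀ x → DecPoset._≤_ P x m → DecPoset._≈_ P x m

{-# OPTIONS --safe #-}
-- (a) If the last vertex of a k-walk w had an out-neighbour u, then w is the
-- initial k-walk of the (k+1)-walk w u, so c w ≰ c (tail of w u); this is
-- impossible when c w is the minimum of P.
-- (b) A walk ending at a sink is never the initial k-walk of a (k+1)-walk, so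
-- its color only occurs on the right of constraints c(init) ≰ c(tail), and
-- lowering a color on the right preserves such a constraint.  Hence lowering
-- the color of every walk ending at a sink to a minimal element below it gives
-- the required coloring; minimal elements below exist because P is finite.
module Submission where

open import Defs
open import Data.Nat using (ℕ; suc)
open import Data.Product using (_×_; Σ; ∃; _,_; proj₁; proj₂)
open import Data.Bool.Properties using (T?; T-irrelevant)
open import Data.Fin using (Fin)
open import Data.Fin.Properties using (any?; all?)
open import Data.Fin.Induction using (po-wellFounded)
open import Data.Vec using (Vec; []; _∷_; _∷ʳ_; last)
open import Data.Unit using (tt)
open import Function.Bundles using (_↔_; Inverse)
open import Induction.WellFounded using (WellFounded; Acc; acc; module Subrelation)
open import Level using (0ℓ)
open import Relation.Binary.Bundles using (DecPoset)
import Relation.Binary.Construct.NonStrictToStrict as ToStrict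
import Relation.Binary.Construct.On as On
import Relation.Binary.Reasoning.PartialOrder as ≤-Reasoning
open import Relation.Binary.PropositionalEquality using (_≡_; refl; cong; cong₂; subst; subst₂; sym)
open import Relation.Nullary using (¬_; Dec; yes; no; ¬?; Irrelevant; contradiction)
open import Relation.Nullary.Decidable using (map′)
open import Relation.Unary using (Pred) renaming (Decidable to DecidablePred)

module _ {A : Set} {m : ℕ} (A↔Fin : A ↔ Fin m) where
  open Inverse A↔Fin

  ∃? : ∀ {ℓ} {Q : Pred A ℓ} → DecidablePred Q → Dec (∃ Q)
  ∃? {Q = Q} Q? = map′ (λ (i , q) → from i , q)
                       (λ (x , q) → to x , subst Q (sym (strictlyInverseʳ x)) q)
                       (any? (λ i → Q? (from i)))

module _ (G : Digraph) where

  sink? : ∀ v → Dec (IsSink G v)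
  sink? v = all? λ u → ¬? (T? (adj G v u))

  IsWalk-irrelevant : ∀ {k} (xs : Vec (Vertex G) k) → Irrelevant (IsWalk G xs)
  IsWalk-irrelevant []           tt      tt        = refl
  IsWalk-irrelevant (x ∷ [])     tt      tt        = refl
  IsWalk-irrelevant (x ∷ y ∷ xs) (e , p) (e′ , p′) =
    cong₂ _,_ (T-irrelevant e e′) (IsWalk-irrelevant (y ∷ xs) p p′)

  walk-≡ : ∀ {k} {w w′ : Walk G k} → proj₁ w ≡ proj₁ w′ → w ≡ w′
  walk-≡ {w = xs , p} {.xs , p′} refl = cong (xs ,_) (IsWalk-irrelevant xs p p′)

  ∷ʳ-isWalk : ∀ {k u} (xs : Vec (Vertex G) (suc k)) →
              IsWalk G xs → Edge G (last xs) u → IsWalk G (xs ∷ʳ u)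
  ∷ʳ-isWalk (x ∷ [])     tt      e = e , tt
  ∷ʳ-isWalk (x ∷ y ∷ xs) (e′ , p) e = e′ , ∷ʳ-isWalk (y ∷ xs) p e

  dropLast-∷ʳ : ∀ {A : Set} {k} (xs : Vec A (suc k)) u → dropLast (xs ∷ʳ u) ≡ xs
  dropLast-∷ʳ (x ∷ [])     u = refl
  dropLast-∷ʳ (x ∷ y ∷ xs) u = cong (x ∷_) (dropLast-∷ʳ (y ∷ xs) u)

  last-dropLast-edge : ∀ {k} (xs : Vec (Vertex G) (suc (suc k))) →
                       IsWalk G xs → Edge G (last (dropLast xs)) (last xs)
  last-dropLast-edge (x ∷ y ∷ [])     (e , tt) = e
  last-dropLast-edge (x ∷ y ∷ z ∷ xs) (e , p)  = last-dropLast-edge (y ∷ z ∷ xs) p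

  extend : ∀ {k u} (w : Walk G (suc k)) → Edge G (walkLast G w) u → Walk G (suc (suc k))
  extend {u = u} (xs , p) e = xs ∷ʳ u , ∷ʳ-isWalk xs p e

  walkInit-extend : ∀ {k u} (w : Walk G (suc k)) (e : Edge G (walkLast G w) u) →
                    walkInit G (extend w e) ≡ w
  walkInit-extend {u = u} (xs , p) e = walk-≡ (dropLast-∷ʳ xs u)

  walkInit-last-not-sink : ∀ {k} (w : Walk G (suc (suc k))) →
                           ¬ IsSink G (walkLast G (walkInit G w))
  walkInit-last-not-sink (xs , p) sink = sink (last xs) (last-dropLast-edge xs p)

module _ (P : DecPoset 0ℓ 0ℓ 0ℓ) (finite : IsFinite P) where
  open DecPoset P renaming (refl to ≤-refl)
  open ToStrict _≈_ _≤_ using (_<_; <⇒≤; <-decidable)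
  open Inverse (proj₂ finite)

  <-wellFounded : WellFounded _<_
  <-wellFounded = Subrelation.wellFounded <⇒<-via-Fin
    (On.wellFounded to (po-wellFounded (On.isPartialOrder from isPartialOrder)))
    where
    <⇒<-via-Fin : ∀ {x y} → x < y → from (to x) < from (to y)
    <⇒<-via-Fin {x} {y} = subst₂ _<_ (sym (strictlyInverseʳ x)) (sym (strictlyInverseʳ y))

  nothing-below⇒minimal : ∀ x → ¬ (∃ λ y → y < x) → IsMinimal P x
  nothing-below⇒minimal x ∄y<x y y≤x with y ≟ x
  ... | yes y≈x = y≈x
  ... | no  y≉x = contradiction (y , (y≤x , y≉x)) ∄y<x

  minimal-below : ∀ x → ∃ λ m → m ≤ x × IsMinimal P m
  minimal-below x = descend x (<-wellFounded x)
    where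
    descend : ∀ x → Acc _<_ x → ∃ λ m → m ≤ x × IsMinimal P m
    descend x (acc below) with ∃? (proj₂ finite) (λ y → <-decidable _≟_ _≤?_ y x)
    ... | yes (y , y<x) = let (m , m≤y , m-minimal) = descend y (below y<x)
                          in m , trans m≤y (<⇒≤ y<x) , m-minimal
    ... | no  ∄y<x      = x , ≤-refl , nothing-below⇒minimal x ∄y<x

module _ (G : Digraph) (P : DecPoset 0ℓ 0ℓ 0ℓ) {k : ℕ} where
  open DecPoset P
  open ≤-Reasoning poset

  minimum-color⇒sink : ∀ {c} → IsColoring G P (suc k) c → ∀ {z} → IsMinimum P z →
                       ∀ w → c w ≈ z → IsSink G (walkLast G w)
  minimum-color⇒sink {c} coloring {z} z-minimum w cw≈z u e = coloring w⁺ (begin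
      c (walkInit G w⁺) ≡⟨ cong c (walkInit-extend G w e) ⟩
      c w               ≈⟨ cw≈z ⟩
      z                 ≤⟨ z-minimum _ ⟩
      c (walkTail G w⁺) ∎)
    where w⁺ = extend G w e

  lowered-coloring : ∀ {c c′} → IsColoring G P (suc k) c → (∀ w → c′ w ≤ c w) →
                     (∀ w → ¬ IsSink G (walkLast G w) → c′ w ≈ c w) →
                     IsColoring G P (suc k) c′
  lowered-coloring {c} {c′} coloring c′≤c agree w c′-violation = coloring w (begin
      c (walkInit G w)  ≈⟨ agree _ (walkInit-last-not-sink G w) ⟨
      c′ (walkInit G w) ≤⟨ c′-violation ⟩
      c′ (walkTail G w) ≤⟨ c′≤c _ ⟩
      c (walkTail G w)  ∎)

module _ (G : Digraph) (P : DecPoset 0ℓ 0ℓ 0ℓ) (finite : IsFinite P) {k : ℕ}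
         (c : Walk G (suc k) → DecPoset.Carrier P) where
  open DecPoset P renaming (refl to ≤-refl)

  lowerAtSinks : Walk G (suc k) → Carrier
  lowerAtSinks w with sink? G (walkLast G w)
  ... | yes _ = proj₁ (minimal-below P finite (c w))
  ... | no  _ = c w

  lowerAtSinks-≤ : ∀ w → lowerAtSinks w ≤ c w
  lowerAtSinks-≤ w with sink? G (walkLast G w)
  ... | yes _ = proj₁ (proj₂ (minimal-below P finite (c w)))
  ... | no  _ = ≤-refl

  lowerAtSinks-nonSink : ∀ w → ¬ IsSink G (walkLast G w) → lowerAtSinks w ≈ c w
  lowerAtSinks-nonSink w ¬sink with sink? G (walkLast G w)
  ... | yes sink = contradiction sink ¬sink
  ... | no  _    = Eq.refl

  lowerAtSinks-minimal : ∀ w → IsSink G (walkLast G w) → IsMinimal P (lowerAtSinks w)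
  lowerAtSinks-minimal w sink with sink? G (walkLast G w)
  ... | yes _     = proj₂ (proj₂ (minimal-below P finite (c w)))
  ... | no  ¬sink = contradiction sink ¬sink

mainTheorem9 : (G : Digraph) (P : DecPoset 0ℓ 0ℓ 0ℓ) → IsFinite P → (k : ℕ) →
    ((z : DecPoset.Carrier P) → IsMinimum P z →
      (c : Walk G (suc k) → DecPoset.Carrier P) → IsColoring G P (suc k) c →
      (w : Walk G (suc k)) → DecPoset._≈_ P (c w) z → IsSink G (walkLast G w))
    ×
    ((∃ λ (c : Walk G (suc k) → DecPoset.Carrier P) → IsColoring G P (suc k) c) →
      Σ (Walk G (suc k) → DecPoset.Carrier P) λ c → IsColoring G P (suc k) c ×
        ((w : Walk G (suc k)) → IsSink G (walkLast G w) → IsMinimal P (c w)))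
mainTheorem9 G P finite k =
    (λ z z-minimum c coloring → minimum-color⇒sink G P coloring z-minimum)
  , λ (c , coloring) →
      lowerAtSinks G P finite c
    , lowered-coloring G P coloring (lowerAtSinks-≤ G P finite c) (lowerAtSinks-nonSink G P finite c)
    , lowerAtSinks-minimal G P finite c
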